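{- Let $\varphi(x;\bar y)$ be a quantifier-free formula in the language $\{<\}$ such that $\mathcal{C}^o_\varphi$ is finitely characterized by $\eta\in 2^{d+1}$, and let $\psi_\varphi(x_1,x_2;\bar y)=\neg(\varphi(x_1;\bar y)\leftrightarrow\varphi(x_2;\bar y))$. Let $\mathbb{Z}^*=\{(2i,2i+1):i\in\mathbb{Z}\}\subseteq\mathbb{Q}^2$. Then $\mathcal{C}^o_{\psi_\varphi}(\mathbb{Z}^*)^{\mathbb{Q}^{|\bar y|}}=[\mathbb{Z}^*]^{\leq d}$.
   Context: All formulas are interpreted in $(\mathbb{Q},<)$. For $\varphi(x;y_1,\dots,y_n)$, $\mathcal{C}^o_\varphi=\{\varphi(\mathbb{Q};a_1,\dots,a_n):a_1<\dots<a_n\in\mathbb{Q}\}$. For $\psi(x_1,x_2;y_1,\dots,y_n)$ and $S\subseteq\mathbb{Q}^2$, $\mathcal{C}^o_\psi(S)^{\mathbb{Q}^n}=\{\{s\in S:\mathbb{Q}\models\psi(s;a_1,\dots,a_n)\}:a_1<\dots<a_n\in\mathbb{Q}\}$. A set $c$ induces $\eta\in 2^{d+1}$ on $B$ if there are $b_0<\dots<b_d$ in $B$ with $b_i\in c$ iff $\eta(i)=1$; $\mathcal{C}\subseteq 2^{\mathbb{Q}}$ is finitely characterized by $\eta$ if for every finite $X_0\subseteq\mathbb{Q}$ and $c\subseteq X_0$: $c\in\{e\cap X_0:e\in\mathcal{C}\}$ iff $c$ does not induce $\eta$ on $X_0$. $[S]^{\le d}$ is the set of subsets of $S$ of size at most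 $d$. -}

module Defs where

open import Data.Nat using (ℕ; zero; suc; _≤_)
open import Data.Integer as ℤ using (ℤ)
open import Data.Fin as Fin using (Fin)
open import Data.Bool using (Bool; true; false; not; _∧_; _∨_; _xor_)
open import Data.List using (List; length)
open import Data.List.Membership.Propositional using (_∈_)
open import Data.Product using (Σ; _×_; ∃)
open import Relation.Nullary using (¬_; does)
open import Relation.Binary.PropositionalEquality using (_≡_)
open import Function.Bundles using (_⇔_)
open import Data.Rational as ℚ using (ℚ)
open import Data.Rational.Properties using (_<?_; _≟_)

-- Quantifier-free formulas in the language {<} with k free variables
-- (variables are Fin k; equality is part of first-order logic).
data QF (k : ℕ) : Set where
  ⊤' ⊥'   : QF k
  _<'_    : Fin k → Fin k → QF k
  _='_    : Fin k → Fin k → QF k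
  ¬'_     : QF k → QF k
  _∧'_    : QF k → QF k → QF k
  _∨'_    : QF k → QF k → QF k

⟦_⟧ : ∀ {k} → QF k → (Fin k → ℚ) → Bool
⟦ ⊤' ⟧ v = true
⟦ ⊥' ⟧ v = false
⟦ i <' j ⟧ v = does (v i <? v j)
⟦ i =' j ⟧ v = does (v i ≟ v j)
⟦ ¬' f ⟧ v = not (⟦ f ⟧ v)
⟦ f ∧' g ⟧ v = ⟦ f ⟧ v ∧ ⟦ g ⟧ v
⟦ f ∨' g ⟧ v = ⟦ f ⟧ v ∨ ⟦ g ⟧ v

val : ∀ {n} → ℚ → (Fin n → ℚ) → Fin (suc n) → ℚ
val x a Fin.zero = x
val x a (Fin.suc j) = a j

sat : ∀ {n} → QF (suc n) → ℚ → (Fin n → ℚ) → Bool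
sat φ x a = ⟦ φ ⟧ (val x a)

Increasing : ∀ {n} → (Fin n → ℚ) → Set
Increasing a = ∀ i j → i Fin.< j → a i ℚ.< a j

-- c (⊆ X₀) belongs to the trace {e ∩ X₀ : e ∈ C^o_φ}
InTrace : ∀ {n} → QF (suc n) → List ℚ → (ℚ → Bool) → Set
InTrace {n} φ X₀ c =
  Σ (Fin n → ℚ) λ a → Increasing a × (∀ q → q ∈ X₀ → c q ≡ sat φ q a)

Induces : ∀ {d} → (ℚ → Bool) → (Fin (suc d) → Bool) → List ℚ → Set
Induces {d} c η B =
  Σ (Fin (suc d) → ℚ) λ b → Increasing b × (∀ i → b i ∈ B) × (∀ i → c (b i) ≡ η i)

FinitelyCharacterized : ∀ {n d} → QF (suc n) → (Fin (suc d) → Bool) → Set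
FinitelyCharacterized φ η =
  ∀ (X₀ : List ℚ) (c : ℚ → Bool) → (∀ q → c q ≡ true → q ∈ X₀) →
    (InTrace φ X₀ c ⇔ (¬ Induces c η X₀))

satψ : ∀ {n} → QF (suc n) → ℚ × ℚ → (Fin n → ℚ) → Bool
satψ φ (x₁ Data.Product., x₂) a = sat φ x₁ a xor sat φ x₂ a

zstar : ℤ → ℚ × ℚ
zstar i = (ℤ.+ 2 ℤ.* i) ℚ./ 1 Data.Product., (ℤ.+ 2 ℤ.* i ℤ.+ ℤ.+ 1) ℚ./ 1

-- A subset T of ℤ* (T i = true iff (2i,2i+1) ∈ T) lies in C^o_ψ(ℤ*)^{ℚⁿ}
InPsiFamily : ∀ {n} → QF (suc n) → (ℤ → Bool) → Set
InPsiFamily {n} φ T =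
  Σ (Fin n → ℚ) λ a → Increasing a × (∀ i → T i ≡ satψ φ (zstar i) a)

AtMost : ℕ → (ℤ → Bool) → Set
AtMost d T = Σ (List ℤ) λ l → length l ≤ d × (∀ i → (T i ≡ true) ⇔ (i ∈ l))

module Submission where

-- The argument only uses that ℤ* is a chain of disjoint closed intervals in increasing
-- order, so the core is developed for an arbitrary such chain (module PairChain):
-- * Order invariance: a quantifier-free φ(x; a) only depends on the position of x among
--   the increasing a. Hence a pair containing no parameter is not split.
-- * Forward (split-pairs-bounded): if a splits the pairs of an increasing list s, choose in
--   d+1 of them the endpoint where φ(·; a) agrees with η; the trace of φ(·; a) on the
--   endpoints would then induce η, which finite characterisation forbids.
-- * Backward (realize): for at most d pairs, colour their endpoints by the alternating word
--   ¬η₀ η₀ ¬η₁ η₁ …, which is too short to contain η (a greedy matching argument). Finite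
--   characterisation realises this colouring by some a; moving every parameter that is
--   not inside a chosen pair into a gap between pairs (relocate) keeps the colouring and
--   leaves all other pairs unsplit.
-- The theorem then follows by listing a bounded set of pairs in increasing order.

open import Defs
open import Data.Nat using (ℕ; suc)
open import Data.Integer using (ℤ)
open import Data.Fin using (Fin)
open import Data.Bool using (Bool)
open import Function.Bundles using (_⇔_)

open import Data.Nat as ℕ using (zero)
import Data.Nat.Properties as ℕP
open import Data.Integer as ℤ using (+_; -[1+_])
import Data.Integer.Properties as ℤP
open import Data.Integer.Tactic.RingSolver using (solve-∀)
import Data.Fin as Fin
open import Data.Fin using (toℕ)
import Data.Fin.Properties as FinP
open import Data.Bool using (true; false; not; _∧_; _∨_; _xor_; if_then_else_)
import Data.Bool.Properties as BoolP
open import Data.Rational as ℚ using (ℚ; mkℚ; *<*; *≤*)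
import Data.Rational.Properties as ℚP
import Data.Nat.Coprimality as Coprime
open import Data.Product using (Σ; _×_; _,_; proj₁; proj₂; ∃-syntax)
open import Data.Sum using (_⊎_; inj₁; inj₂)
open import Data.Empty using (⊥-elim)
open import Relation.Nullary using (¬_; Dec; does; yes; no)
open import Relation.Nullary.Decidable using (dec-true; dec-false; _×-dec_)
open import Relation.Binary.Definitions using (tri<; tri≈; tri>)
open import Relation.Binary.PropositionalEquality
open import Function.Bundles using (mk⇔; Equivalence)
open import Function.Base using (_∘_)
open import Data.List as List using (List; []; _∷_; length)
open import Data.List.Relation.Unary.All as All using (All; []; _∷_)
open import Data.List.Relation.Unary.AllPairs using (AllPairs; []; _∷_)
import Data.List.Relation.Unary.AllPairs.Properties as AllPairsP
import Data.List.Relation.Unary.Any as Any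
open import Data.List.Relation.Unary.Any using (here; there)
open import Data.List.Relation.Unary.Any.Properties using (lookup-index)
open import Data.List.Membership.Propositional using (_∈_)
open import Data.List.Membership.Propositional.Properties using (∈-lookup; ∈-filter⁺; ∈-filter⁻; ∈-map⁺; ∈-allFin)
open import Data.List.Membership.DecPropositional ℚP._≟_ using (_∈?_)
open import Data.List.Extrema.Nat using (max; xs≤max)

SameOrder : ℚ → ℚ → ℚ → ℚ → Set
SameOrder p q p' q' = (p ℚ.< q × p' ℚ.< q') ⊎ (q ℚ.< p × q' ℚ.< p') ⊎ (p ≡ q × p' ≡ q')

sameOrder-refl : ∀ p q → SameOrder p q p q
sameOrder-refl p q with ℚP.<-cmp p q
... | tri< p<q _ _ = inj₁ (p<q , p<q)
... | tri≈ _ p≡q _ = inj₂ (inj₂ (p≡q , p≡q))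
... | tri> _ _ q<p = inj₂ (inj₁ (q<p , q<p))

sameOrder-swap : ∀ {p q p' q'} → SameOrder p q p' q' → SameOrder q p q' p'
sameOrder-swap (inj₁ lt) = inj₂ (inj₁ lt)
sameOrder-swap (inj₂ (inj₁ gt)) = inj₁ gt
sameOrder-swap (inj₂ (inj₂ (e , e'))) = inj₂ (inj₂ (sym e , sym e'))

<?-sameOrder : ∀ {p q p' q'} → SameOrder p q p' q' → does (p ℚP.<? q) ≡ does (p' ℚP.<? q')
<?-sameOrder {p} {q} {p'} {q'} (inj₁ (lt , lt')) =
  trans (dec-true (p ℚP.<? q) lt) (sym (dec-true (p' ℚP.<? q') lt'))
<?-sameOrder {p} {q} {p'} {q'} (inj₂ (inj₁ (gt , gt'))) =
  trans (dec-false (p ℚP.<? q) (ℚP.<-asym gt)) (sym (dec-false (p' ℚP.<? q') (ℚP.<-asym gt')))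
<?-sameOrder {p} {_} {p'} (inj₂ (inj₂ (refl , refl))) =
  trans (dec-false (p ℚP.<? p) (ℚP.<-irrefl refl)) (sym (dec-false (p' ℚP.<? p') (ℚP.<-irrefl refl)))

≟-sameOrder : ∀ {p q p' q'} → SameOrder p q p' q' → does (p ℚP.≟ q) ≡ does (p' ℚP.≟ q')
≟-sameOrder {p} {q} {p'} {q'} (inj₁ (lt , lt')) =
  trans (dec-false (p ℚP.≟ q) (ℚP.<⇒≢ lt)) (sym (dec-false (p' ℚP.≟ q') (ℚP.<⇒≢ lt')))
≟-sameOrder {p} {q} {p'} {q'} (inj₂ (inj₁ (gt , gt'))) =
  trans (dec-false (p ℚP.≟ q) (ℚP.<⇒≢ gt ∘ sym)) (sym (dec-false (p' ℚP.≟ q') (ℚP.<⇒≢ gt' ∘ sym)))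
≟-sameOrder {p} {q} {p'} {q'} (inj₂ (inj₂ (e , e'))) =
  trans (dec-true (p ℚP.≟ q) e) (sym (dec-true (p' ℚP.≟ q') e'))

⟦⟧-sameOrder : ∀ {k} (f : QF k) {v v' : Fin k → ℚ} →
  (∀ i j → SameOrder (v i) (v j) (v' i) (v' j)) → ⟦ f ⟧ v ≡ ⟦ f ⟧ v'
⟦⟧-sameOrder ⊤' h = refl
⟦⟧-sameOrder ⊥' h = refl
⟦⟧-sameOrder (i <' j) h = <?-sameOrder (h i j)
⟦⟧-sameOrder (i =' j) h = ≟-sameOrder (h i j)
⟦⟧-sameOrder (¬' f) h = cong not (⟦⟧-sameOrder f h)
⟦⟧-sameOrder (f ∧' g) h = cong₂ _∧_ (⟦⟧-sameOrder f h) (⟦⟧-sameOrder g h)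
⟦⟧-sameOrder (f ∨' g) h = cong₂ _∨_ (⟦⟧-sameOrder f h) (⟦⟧-sameOrder g h)

increasing-sameOrder : ∀ {n} {a b : Fin n → ℚ} → Increasing a → Increasing b →
  ∀ i j → SameOrder (a i) (a j) (b i) (b j)
increasing-sameOrder a↑ b↑ i j with FinP.<-cmp i j
... | tri< i<j _ _ = inj₁ (a↑ i j i<j , b↑ i j i<j)
... | tri≈ _ refl _ = inj₂ (inj₂ (refl , refl))
... | tri> _ _ j<i = inj₂ (inj₁ (a↑ j i j<i , b↑ j i j<i))

sat-sameOrder : ∀ {n} (φ : QF (suc n)) {x y} {a b : Fin n → ℚ} → Increasing a → Increasing b →
  (∀ j → SameOrder x (a j) y (b j)) → sat φ x a ≡ sat φ y b
sat-sameOrder φ {x} {y} {a} {b} a↑ b↑ h = ⟦⟧-sameOrder φ valuations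
  where
  valuations : ∀ i j → SameOrder (val x a i) (val x a j) (val y b i) (val y b j)
  valuations Fin.zero Fin.zero = inj₂ (inj₂ (refl , refl))
  valuations Fin.zero (Fin.suc j) = h j
  valuations (Fin.suc i) Fin.zero = sameOrder-swap (h i)
  valuations (Fin.suc i) (Fin.suc j) = increasing-sameOrder a↑ b↑ i j

ι : ℤ → ℚ
ι z = z ℚ./ 1

ι-normal : ∀ z → ι z ≡ mkℚ z 0 (Coprime.sym (Coprime.1-coprimeTo ℤ.∣ z ∣))
ι-normal (+ n) = ℚP.normalize-coprime (Coprime.sym (Coprime.1-coprimeTo n))
ι-normal -[1+ n ] = cong ℚ.-_ (ℚP.normalize-coprime (Coprime.sym (Coprime.1-coprimeTo (suc n))))

↥ι : ∀ z → ℚ.↥ (ι z) ≡ z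
↥ι z = cong ℚ.↥_ (ι-normal z)

↧ι : ∀ z → ℚ.↧ (ι z) ≡ + 1
↧ι z = cong ℚ.↧_ (ι-normal z)

-- Cross-multiplying ι z against ι w gives back z; this turns order on ι into order on ℤ.
ι-cross : ∀ z w → ℚ.↥ (ι z) ℤ.* ℚ.↧ (ι w) ≡ z
ι-cross z w = trans (cong₂ ℤ._*_ (↥ι z) (↧ι w)) (ℤP.*-identityʳ z)

ι-mono-< : ∀ {z w} → z ℤ.< w → ι z ℚ.< ι w
ι-mono-< {z} {w} z<w = *<* (subst₂ ℤ._<_ (sym (ι-cross z w)) (sym (ι-cross w z)) z<w)

ι-mono-≤ : ∀ {z w} → z ℤ.≤ w → ι z ℚ.≤ ι w
ι-mono-≤ {z} {w} z≤w = *≤* (subst₂ ℤ._≤_ (sym (ι-cross z w)) (sym (ι-cross w z)) z≤w)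

ι-cancel-≤ : ∀ {z w} → ι z ℚ.≤ ι w → z ℤ.≤ w
ι-cancel-≤ {z} {w} (*≤* le) = subst₂ ℤ._≤_ (ι-cross z w) (ι-cross w z) le

-- ι commutes with negation (used to transfer upper bounds to lower bounds).
ι-neg : ∀ z → ι (ℤ.- z) ≡ ℚ.- ι z
ι-neg z = ℚP.≃⇒≡ (ℚ.*≡* (begin
  ℚ.↥ (ι (ℤ.- z)) ℤ.* ℚ.↧ (ℚ.- ι z)   ≡⟨ cong₂ ℤ._*_ (↥ι (ℤ.- z)) (trans (ℚP.↧-neg (ι z)) (↧ι z)) ⟩
  ℤ.- z ℤ.* + 1                        ≡⟨ cong₂ ℤ._*_ (cong ℤ.-_ (sym (↥ι z))) (sym (↧ι (ℤ.- z))) ⟩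
  ℤ.- ℚ.↥ (ι z) ℤ.* ℚ.↧ (ι (ℤ.- z))    ≡⟨ cong (ℤ._* ℚ.↧ (ι (ℤ.- z))) (sym (ℚP.↥-neg (ι z))) ⟩
  ℚ.↥ (ℚ.- ι z) ℤ.* ℚ.↧ (ι (ℤ.- z))    ∎))
  where open ≡-Reasoning

neg-involutive : ∀ q → ℚ.- (ℚ.- q) ≡ q
neg-involutive (mkℚ -[1+ _ ] _ _) = refl
neg-involutive (mkℚ (+ zero) _ _) = refl
neg-involutive (mkℚ (+ suc _) _ _) = refl

numBound : ℚ → ℕ
numBound q = ℤ.∣ ℚ.↥ q ∣

ι-upper : ∀ q → q ℚ.≤ ι (+ numBound q)
ι-upper q@(mkℚ x d _) = *≤* (begin
  x ℤ.* ℚ.↧ (ι (+ ℤ.∣ x ∣))      ≡⟨ trans (cong (x ℤ.*_) (↧ι (+ ℤ.∣ x ∣))) (ℤP.*-identityʳ x) ⟩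
  x                              ≤⟨ i≤∣i∣ x ⟩
  + ℤ.∣ x ∣                      ≤⟨ ℤ.+≤+ (ℕP.m≤m*n ℤ.∣ x ∣ (suc d)) ⟩
  + (ℤ.∣ x ∣ ℕ.* suc d)          ≡⟨ ℤP.pos-* ℤ.∣ x ∣ (suc d) ⟩
  + ℤ.∣ x ∣ ℤ.* + suc d          ≡⟨ cong (ℤ._* + suc d) (sym (↥ι (+ ℤ.∣ x ∣))) ⟩
  ℚ.↥ (ι (+ ℤ.∣ x ∣)) ℤ.* + suc d ∎)
  where
  open ℤP.≤-Reasoning
  i≤∣i∣ : ∀ i → i ℤ.≤ + ℤ.∣ i ∣
  i≤∣i∣ (+ _) = ℤP.≤-refl
  i≤∣i∣ -[1+ _ ] = ℤ.-≤+

ι-lower : ∀ q → ι (ℤ.- (+ numBound q)) ℚ.≤ q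
ι-lower q = subst₂ ℚ._≤_ (sym (trans (ι-neg (+ numBound q)) (cong (λ m → ℚ.- ι (+ m)) same-bound)))
                         (neg-involutive q)
                         (ℚP.neg-antimono-≤ (ι-upper (ℚ.- q)))
  where
  same-bound : numBound q ≡ numBound (ℚ.- q)
  same-bound = sym (trans (cong ℤ.∣_∣ (ℚP.↥-neg q)) (ℤP.∣-i∣≡∣i∣ (ℚ.↥ q)))

lookup-pairwise : ∀ {A : Set} {R : A → A → Set} {xs : List A} → AllPairs R xs →
  ∀ {u v} → u Fin.< v → R (List.lookup xs u) (List.lookup xs v)
lookup-pairwise {xs = x ∷ xs} (x-R ∷ _) {Fin.zero} {Fin.suc v} _ = All.lookup x-R (∈-lookup v)
lookup-pairwise {xs = x ∷ xs} (_ ∷ xs-R) {Fin.suc u} {Fin.suc v} (ℕ.s≤s u<v) = lookup-pairwise xs-R u<v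

repetition-free-length : ∀ {A : Set} {R : A → A → Set} → (∀ {x} → ¬ R x x) →
  ∀ {s l : List A} → AllPairs R s → (∀ {x} → x ∈ s → x ∈ l) → length s ℕ.≤ length l
repetition-free-length {R = R} irrefl {s} {l} s-R s⊆l with length s ℕ.≤? length l
... | yes fits = fits
... | no too-long = ⊥-elim (collision (FinP.pigeonhole (ℕP.≰⇒> too-long) slot))
  where
  slot : Fin (length s) → Fin (length l)
  slot u = Any.index (s⊆l (∈-lookup u))
  same-entry : ∀ u v → slot u ≡ slot v → List.lookup s u ≡ List.lookup s v
  same-entry u v same = trans (lookup-index (s⊆l (∈-lookup u)))
                              (trans (cong (List.lookup l) same) (sym (lookup-index (s⊆l (∈-lookup v)))))
  collision : ¬ (∃[ u ] ∃[ v ] u Fin.< v × slot u ≡ slot v)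
  collision (u , v , u<v , same) =
    irrefl (subst (R (List.lookup s u)) (sym (same-entry u v same)) (lookup-pairwise s-R u<v))

≤max : ∀ {m ms} → m ∈ ms → m ℕ.≤ max 0 ms
≤max {ms = ms} m∈ms = All.lookup (xs≤max 0 ms) m∈ms

abs-bound : ∀ {i K} → ℤ.∣ i ∣ ℕ.≤ K → ℤ.- (+ K) ℤ.≤ i × i ℤ.≤ + K
abs-bound {+ _} i≤K = ℤP.neg-≤-pos , ℤ.+≤+ i≤K
abs-bound { -[1+ _ ]} {suc _} (ℕ.s≤s i≤K) = ℤ.-≤- i≤K , ℤ.-≤+

listBound : List ℤ → ℕ
listBound l = max 0 (List.map ℤ.∣_∣ l)

listed-bound : ∀ {i l} → i ∈ l → ℤ.- (+ listBound l) ℤ.≤ i × i ℤ.≤ + listBound l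
listed-bound i∈l = abs-bound (≤max (∈-map⁺ ℤ.∣_∣ i∈l))

range : ℤ → ℕ → List ℤ
range z zero = []
range z (suc k) = z ∷ range (ℤ.suc z) k

range-lower : ∀ z k {x} → x ∈ range z k → z ℤ.≤ x
range-lower z (suc k) (here refl) = ℤP.≤-refl
range-lower z (suc k) (there x∈) = ℤP.<⇒≤ (ℤP.suc[i]≤j⇒i<j (range-lower (ℤ.suc z) k x∈))

range-increasing : ∀ z k → AllPairs ℤ._<_ (range z k)
range-increasing z zero = []
range-increasing z (suc k) =
  All.tabulate (λ x∈ → ℤP.suc[i]≤j⇒i<j (range-lower (ℤ.suc z) k x∈)) ∷ range-increasing (ℤ.suc z) k

range-complete : ∀ z k {x} → z ℤ.≤ x → x ℤ.< z ℤ.+ + k → x ∈ range z k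
range-complete z zero {x} z≤x x<z =
  ⊥-elim (ℤP.<-irrefl refl (ℤP.<-≤-trans (subst (x ℤ.<_) (ℤP.+-identityʳ z) x<z) z≤x))
range-complete z (suc k) {x} z≤x x<z+k with x ℤP.≟ z
... | yes x≡z = here x≡z
... | no x≢z = there (range-complete (ℤ.suc z) k (ℤP.i<j⇒suc[i]≤j (ℤP.≤∧≢⇒< z≤x (x≢z ∘ sym)))
                       (subst (x ℤ.<_) (shift z (+ k)) x<z+k))
  where
  shift : ∀ z w → z ℤ.+ (+ 1 ℤ.+ w) ≡ (+ 1 ℤ.+ z) ℤ.+ w
  shift = solve-∀

IncreasingListing : (ℤ → Bool) → Set
IncreasingListing T = Σ (List ℤ) λ s → AllPairs ℤ._<_ s × (∀ i → (T i ≡ true) ⇔ (i ∈ s))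

increasing-listing-shortest : ∀ {T : ℤ → Bool} {s l} → AllPairs ℤ._<_ s →
  (∀ i → (T i ≡ true) ⇔ (i ∈ s)) → (∀ i → (T i ≡ true) ⇔ (i ∈ l)) → length s ℕ.≤ length l
increasing-listing-shortest s↑ T⇔s T⇔l = repetition-free-length (ℤP.<-irrefl refl) s↑
  (λ {x} x∈s → Equivalence.to (T⇔l x) (Equivalence.from (T⇔s x) x∈s))

enumerate : (T : ℤ → Bool) (K : ℕ) → (∀ i → T i ≡ true → ℤ.- (+ K) ℤ.≤ i × i ℤ.≤ + K) →
  IncreasingListing T
enumerate T K bounded = List.filter T? window
                      , AllPairsP.filter⁺ T? (range-increasing (ℤ.- (+ K)) (suc (K ℕ.+ K)))
                      , λ i → mk⇔ (λ Ti → ∈-filter⁺ T? (in-window i (bounded i Ti)) Ti) (proj₂ ∘ ∈-filter⁻ T?)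
  where
  T? : ∀ i → Dec (T i ≡ true)
  T? i = T i BoolP.≟ true
  window : List ℤ
  window = range (ℤ.- (+ K)) (suc (K ℕ.+ K))
  width : ∀ w → ℤ.- w ℤ.+ (+ 1 ℤ.+ (w ℤ.+ w)) ≡ + 1 ℤ.+ w
  width = solve-∀
  in-window : ∀ i → ℤ.- (+ K) ℤ.≤ i × i ℤ.≤ + K → i ∈ window
  in-window i (-K≤i , i≤K) = range-complete _ _ -K≤i
    (subst (i ℤ.<_) (sym (width (+ K))) (ℤP.suc[i]≤j⇒i<j (ℤP.suc-mono i≤K)))

same-truth : ∀ {P : Set} {b b' : Bool} → (b ≡ true) ⇔ P → (b' ≡ true) ⇔ P → b ≡ b'
same-truth {b = true} b⇔P b'⇔P = sym (Equivalence.from b'⇔P (Equivalence.to b⇔P refl))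
same-truth {b = false} {true} b⇔P b'⇔P = Equivalence.from b⇔P (Equivalence.to b'⇔P refl)
same-truth {b = false} {false} _ _ = refl

extend : ∀ {d} → (Fin (suc d) → Bool) → ℕ → Bool
extend {d} η m with m ℕ.<? suc d
... | yes m<d = η (Fin.fromℕ< m<d)
... | no _ = false

extend-toℕ : ∀ {d} (η : Fin (suc d) → Bool) t → extend η (toℕ t) ≡ η t
extend-toℕ {d} η t with toℕ t ℕ.<? suc d
... | yes t<d = cong η (FinP.fromℕ<-toℕ t t<d)
... | no t≮d = ⊥-elim (t≮d (FinP.toℕ<n t))

-- The restriction of f to the finite set X₀ (false outside X₀); the sets c in the
-- definition of finite characterisation are of this form.
restrict : List ℚ → (ℚ → Bool) → ℚ → Bool
restrict X₀ f q = if does (q ∈? X₀) then f q else false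

restrict-in : ∀ X₀ f {q} → q ∈ X₀ → restrict X₀ f q ≡ f q
restrict-in X₀ f {q} q∈X₀ rewrite dec-true (q ∈? X₀) q∈X₀ = refl

restrict-sub : ∀ X₀ f q → restrict X₀ f q ≡ true → q ∈ X₀
restrict-sub X₀ f q c≡true with q ∈? X₀
... | yes q∈X₀ = q∈X₀
... | no _ with () ← c≡true

-- double t = 2t, defined so that double (suc t) = suc (suc (double t)) holds by computation.
double : ℕ → ℕ
double zero = zero
double (suc t) = suc (suc (double t))

double-mono : ∀ {m n} → m ℕ.≤ n → double m ℕ.≤ double n
double-mono ℕ.z≤n = ℕ.z≤n
double-mono (ℕ.s≤s m≤n) = ℕ.s≤s (ℕ.s≤s (double-mono m≤n))

alternating : (ℕ → Bool) → ℕ → Bool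
alternating e zero = not (e 0)
alternating e (suc zero) = e 0
alternating e (suc (suc r)) = alternating (e ∘ suc) r

alternating-even : ∀ e t → alternating e (double t) ≡ not (e t)
alternating-even e zero = refl
alternating-even e (suc t) = alternating-even (e ∘ suc) t

alternating-odd : ∀ e t → alternating e (suc (double t)) ≡ e t
alternating-odd e zero = refl
alternating-odd e (suc t) = alternating-odd (e ∘ suc) t

-- Greedy matching: if positions r₀ < … < r_d of the alternating word spell e₀ … e_d,
-- then r_t > 2t, since e_t can be matched at the earliest at position 2t + 1.
alternating-late : ∀ {d} (e : ℕ → Bool) (r : Fin (suc d) → ℕ) →
  (∀ u v → u Fin.< v → r u ℕ.< r v) → (∀ t → alternating e (r t) ≡ e (toℕ t)) →
  ∀ t → double (toℕ t) ℕ.< r t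
alternating-late e r r↑ spells t = late (toℕ t) t refl
  where
  unmatched : ∀ t → double (toℕ t) ≢ r t
  unmatched t 2t≡r = BoolP.not-¬ refl (trans (sym (spells t))
    (trans (cong (alternating e) (sym 2t≡r)) (alternating-even e (toℕ t))))
  late : ∀ m t → toℕ t ≡ m → double m ℕ.< r t
  late zero t t≡0 = ℕP.≤∧≢⇒< ℕ.z≤n (λ 0≡r → unmatched t (trans (cong double t≡0) 0≡r))
  late (suc m) (Fin.suc u) su≡sm =
    ℕP.≤∧≢⇒< (ℕP.≤-trans (ℕ.s≤s earlier) (r↑ (Fin.inject₁ u) (Fin.suc u) u<su))
             (λ 2m≡r → unmatched (Fin.suc u) (trans (cong double su≡sm) 2m≡r))
    where
    earlier : double m ℕ.< r (Fin.inject₁ u)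
    earlier = late m (Fin.inject₁ u) (trans (FinP.toℕ-inject₁ u) (ℕP.suc-injective su≡sm))
    u<su : Fin.inject₁ u Fin.< Fin.suc u
    u<su = subst (ℕ._< suc (toℕ u)) (sym (FinP.toℕ-inject₁ u)) ℕP.≤-refl

module IncreasingSequence {lo hi : ℚ} (lo<hi : lo ℚ.< hi) where

  private
    next : ℕ → Σ ℚ λ q → lo ℚ.< q × q ℚ.< hi
    next zero = ℚP.<-dense lo<hi
    next (suc j) with q , lo<q , q<hi ← next j with q' , q<q' , q'<hi ← ℚP.<-dense q<hi =
      q' , ℚP.<-trans lo<q q<q' , q'<hi

  point : ℕ → ℚ
  point j = proj₁ (next j)

  point-lower : ∀ j → lo ℚ.< point j
  point-lower j = proj₁ (proj₂ (next j))

  point-upper : ∀ j → point j ℚ.< hi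
  point-upper j = proj₂ (proj₂ (next j))

  point-step : ∀ j → point j ℚ.< point (suc j)
  point-step j = proj₁ (proj₂ (ℚP.<-dense (point-upper j)))

  point-mono : ∀ {j j'} → j ℕ.< j' → point j ℚ.< point j'
  point-mono {j} {suc j'} (ℕ.s≤s j≤j') with ℕP.m≤n⇒m<n∨m≡n j≤j'
  ... | inj₁ j<j' = ℚP.<-trans (point-mono j<j') (point-step j')
  ... | inj₂ refl = point-step j

reflects-< : ∀ {f : ℤ → ℚ} → (∀ {i k} → i ℤ.< k → f i ℚ.< f k) → ∀ {i k} → f i ℚ.< f k → i ℤ.< k
reflects-< {f} mono {i} {k} fi<fk with ℤP.<-cmp i k
... | tri< i<k _ _ = i<k
... | tri≈ _ refl _ = ⊥-elim (ℚP.<-irrefl refl fi<fk)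
... | tri> _ _ k<i = ⊥-elim (ℚP.<-asym fi<fk (mono k<i))

-- A chain of pairs: closed intervals [left i, right i] indexed by ℤ and arranged
-- increasingly. ℤ* is such a chain; everything in this module only uses the two axioms.
module PairChain (left right : ℤ → ℚ)
                 (left<right : ∀ i → left i ℚ.< right i)
                 (right<left : ∀ {i k} → i ℤ.< k → right i ℚ.< left k) where

  InPair : ℤ → ℚ → Set
  InPair i x = left i ℚ.≤ x × x ℚ.≤ right i

  inPair? : ∀ i x → Dec (InPair i x)
  inPair? i x = (left i ℚP.≤? x) ×-dec (x ℚP.≤? right i)

  left-mono : ∀ {i k} → i ℤ.< k → left i ℚ.< left k
  left-mono {i} i<k = ℚP.<-trans (left<right i) (right<left i<k)

  right-mono : ∀ {i k} → i ℤ.< k → right i ℚ.< right k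
  right-mono {k = k} i<k = ℚP.<-trans (right<left i<k) (left<right k)

  right-mono-≤ : ∀ {i k} → i ℤ.≤ k → right i ℚ.≤ right k
  right-mono-≤ {i} {k} i≤k with i ℤP.≟ k
  ... | yes refl = ℚP.≤-refl
  ... | no i≢k = ℚP.<⇒≤ (right-mono (ℤP.≤∧≢⇒< i≤k i≢k))

  pair-unique : ∀ {i k x} → InPair i x → InPair k x → i ≡ k
  pair-unique {i} {k} (li≤x , x≤ri) (lk≤x , x≤rk) with ℤP.<-cmp i k
  ... | tri< i<k _ _ = ⊥-elim (ℚP.<-irrefl refl (ℚP.≤-<-trans lk≤x (ℚP.≤-<-trans x≤ri (right<left i<k))))
  ... | tri≈ _ i≡k _ = i≡k
  ... | tri> _ _ k<i = ⊥-elim (ℚP.<-irrefl refl (ℚP.≤-<-trans li≤x (ℚP.≤-<-trans x≤rk (right<left k<i))))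

  outside-pair-sameOrder : ∀ {i x} → ¬ InPair i x → SameOrder (left i) x (right i) x
  outside-pair-sameOrder {i} {x} x∉i with x ℚP.<? left i
  ... | yes x<l = inj₂ (inj₁ (x<l , ℚP.<-trans x<l (left<right i)))
  ... | no x≮l with x ℚP.≤? right i
  ...   | yes x≤r = ⊥-elim (x∉i (ℚP.≮⇒≥ x≮l , x≤r))
  ...   | no x≰r = inj₁ (ℚP.<-trans (left<right i) (ℚP.≰⇒> x≰r) , ℚP.≰⇒> x≰r)

  -- The open gap (right (i - 1), left i) just before pair i, with an increasing
  -- sequence of points in it.
  module Gap (i : ℤ) = IncreasingSequence (right<left {ℤ.pred i} {i} (ℤP.i≤pred[j]⇒i<j ℤP.≤-refl))

  gapPoint : ℤ → ℕ → ℚ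
  gapPoint i = Gap.point i

  gap-avoids-pairs : ∀ i j k → ¬ InPair k (gapPoint i j)
  gap-avoids-pairs i j k (lk≤g , g≤rk) = ℤP.<-irrefl refl (ℤP.<-≤-trans k<i i≤k)
    where
    k<i : k ℤ.< i
    k<i = reflects-< left-mono (ℚP.≤-<-trans lk≤g (Gap.point-upper i j))
    i≤k : i ℤ.≤ k
    i≤k = subst (ℤ._≤ k) (ℤP.suc-pred i)
            (ℤP.i<j⇒suc[i]≤j (reflects-< right-mono (ℚP.<-≤-trans (Gap.point-lower i j) g≤rk)))

  right-below-gap : ∀ {p i} j → p ℤ.< i → right p ℚ.< gapPoint i j
  right-below-gap {p} {i} j p<i = ℚP.≤-<-trans (right-mono-≤ (ℤP.i<j⇒i≤pred[j] p<i)) (Gap.point-lower i j)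

  points : List ℤ → List ℚ
  points [] = []
  points (i ∷ s) = left i ∷ right i ∷ points s

  left∈points : ∀ {s i} → i ∈ s → left i ∈ points s
  left∈points (here refl) = here refl
  left∈points (there i∈s) = there (there (left∈points i∈s))

  right∈points : ∀ {s i} → i ∈ s → right i ∈ points s
  right∈points (here refl) = there (here refl)
  right∈points (there i∈s) = there (there (right∈points i∈s))

  points-above : ∀ {p} s → All (p ℤ.<_) s → ∀ {q} → q ∈ points s → right p ℚ.< q
  points-above (k ∷ s) (p<k ∷ _) (here refl) = right<left p<k
  points-above (k ∷ s) (p<k ∷ _) (there (here refl)) = right-mono p<k
  points-above (k ∷ s) (_ ∷ p<s) (there (there q∈s)) = points-above s p<s q∈s

  points-from : ∀ {i s} → All (i ℤ.<_) s → ∀ {q} → q ∈ points (i ∷ s) → left i ℚ.≤ q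
  points-from i<s (here refl) = ℚP.≤-refl
  points-from {i} i<s (there (here refl)) = ℚP.<⇒≤ (left<right i)
  points-from {i} {s} i<s (there (there q∈s)) = ℚP.<⇒≤ (ℚP.<-trans (left<right i) (points-above s i<s q∈s))

  relocate : ℤ → List ℤ → ℚ → ℕ → ℚ
  relocate p [] x j = gapPoint (ℤ.suc p) j
  relocate p (i ∷ s) x j with x ℚP.<? left i
  ... | yes _ = gapPoint i j
  ... | no _ with x ℚP.≤? right i
  ...   | yes _ = x
  ...   | no _ = relocate i s x j

  relocate-above : ∀ p s → All (p ℤ.<_) s → AllPairs ℤ._<_ s → ∀ {y} j →
    right p ℚ.< y → right p ℚ.< relocate p s y j
  relocate-above p [] _ _ j _ = right-below-gap j (ℤP.suc[i]≤j⇒i<j ℤP.≤-refl)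
  relocate-above p (i ∷ s) (p<i ∷ p<s) (i<s ∷ s↑) {y} j rp<y with y ℚP.<? left i
  ... | yes _ = right-below-gap j p<i
  ... | no _ with y ℚP.≤? right i
  ...   | yes _ = rp<y
  ...   | no y≰r = ℚP.<-trans (right-mono p<i) (relocate-above i s i<s s↑ j (ℚP.≰⇒> y≰r))

  relocate-mono : ∀ p s → AllPairs ℤ._<_ s → ∀ {x y j j'} → x ℚ.< y → j ℕ.< j' →
    relocate p s x j ℚ.< relocate p s y j'
  relocate-mono p [] _ _ j<j' = Gap.point-mono (ℤ.suc p) j<j'
  relocate-mono p (i ∷ s) (i<s ∷ s↑) {x} {y} {j} {j'} x<y j<j' with x ℚP.<? left i | y ℚP.<? left i
  ... | yes _ | yes _ = Gap.point-mono i j<j'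
  ... | yes _ | no y≮l with y ℚP.≤? right i
  ...   | yes _ = ℚP.<-≤-trans (Gap.point-upper i j) (ℚP.≮⇒≥ y≮l)
  ...   | no y≰r = ℚP.<-trans (ℚP.<-trans (Gap.point-upper i j) (left<right i))
                     (relocate-above i s i<s s↑ j' (ℚP.≰⇒> y≰r))
  relocate-mono p (i ∷ s) _ x<y _ | no x≮l | yes y<l =
    ⊥-elim (ℚP.<-asym y<l (ℚP.≤-<-trans (ℚP.≮⇒≥ x≮l) x<y))
  relocate-mono p (i ∷ s) (i<s ∷ s↑) {x} {y} {j} {j'} x<y j<j' | no _ | no _
    with x ℚP.≤? right i | y ℚP.≤? right i
  ... | yes _ | yes _ = x<y
  ... | yes x≤r | no y≰r = ℚP.≤-<-trans x≤r (relocate-above i s i<s s↑ j' (ℚP.≰⇒> y≰r))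
  ... | no x≰r | yes y≤r = ⊥-elim (ℚP.<-irrefl refl (ℚP.<-≤-trans (ℚP.<-trans (ℚP.≰⇒> x≰r) x<y) y≤r))
  ... | no _ | no _ = relocate-mono i s s↑ x<y j<j'

  relocate-sameOrder : ∀ p s → AllPairs ℤ._<_ s → ∀ {q} → q ∈ points s → ∀ x j →
    SameOrder q x q (relocate p s x j)
  relocate-sameOrder p (i ∷ s) (i<s ∷ s↑) {q} q∈ x j with x ℚP.<? left i
  ... | yes x<l = inj₂ (inj₁ (ℚP.<-≤-trans x<l l≤q , ℚP.<-≤-trans (Gap.point-upper i j) l≤q))
    where l≤q = points-from i<s q∈
  ... | no _ with x ℚP.≤? right i
  ...   | yes _ = sameOrder-refl q x
  ...   | no x≰r = beyond q∈
    where
    r<x' : right i ℚ.< relocate i s x j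
    r<x' = relocate-above i s i<s s↑ j (ℚP.≰⇒> x≰r)
    beyond : ∀ {q} → q ∈ points (i ∷ s) → SameOrder q x q (relocate i s x j)
    beyond (here refl) = inj₁ (ℚP.<-trans (left<right i) (ℚP.≰⇒> x≰r) , ℚP.<-trans (left<right i) r<x')
    beyond (there (here refl)) = inj₁ (ℚP.≰⇒> x≰r , r<x')
    beyond (there (there q∈s)) = relocate-sameOrder i s s↑ q∈s x j

  relocate-avoids : ∀ p s x j k → InPair k (relocate p s x j) → k ∈ s
  relocate-avoids p [] x j k k∋x' = ⊥-elim (gap-avoids-pairs (ℤ.suc p) j k k∋x')
  relocate-avoids p (i ∷ s) x j k k∋x' with x ℚP.<? left i
  ... | yes _ = ⊥-elim (gap-avoids-pairs i j k k∋x')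
  ... | no x≮l with x ℚP.≤? right i
  ...   | yes x≤r = here (sym (pair-unique (ℚP.≮⇒≥ x≮l , x≤r) k∋x'))
  ...   | no _ = there (relocate-avoids i s x j k k∋x')

  rank : List ℤ → ℚ → ℕ
  rank [] q = 0
  rank (i ∷ s) q with q ℚP.≟ left i
  ... | yes _ = 0
  ... | no _ with q ℚP.≟ right i
  ...   | yes _ = 1
  ...   | no _ = suc (suc (rank s q))

  rank-left : ∀ i s → rank (i ∷ s) (left i) ≡ 0
  rank-left i s with left i ℚP.≟ left i
  ... | yes _ = refl
  ... | no l≢l = ⊥-elim (l≢l refl)

  rank-right : ∀ i s → rank (i ∷ s) (right i) ≡ 1
  rank-right i s with right i ℚP.≟ left i
  ... | yes r≡l = ⊥-elim (ℚP.<-irrefl (sym r≡l) (left<right i))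
  ... | no _ with right i ℚP.≟ right i
  ...   | yes _ = refl
  ...   | no r≢r = ⊥-elim (r≢r refl)

  rank-beyond : ∀ i s {q} → right i ℚ.< q → rank (i ∷ s) q ≡ suc (suc (rank s q))
  rank-beyond i s {q} r<q with q ℚP.≟ left i
  ... | yes refl = ⊥-elim (ℚP.<-asym r<q (left<right i))
  ... | no _ with q ℚP.≟ right i
  ...   | yes refl = ⊥-elim (ℚP.<-irrefl refl r<q)
  ...   | no _ = refl

  rank-mono : ∀ s → AllPairs ℤ._<_ s → ∀ {q q'} → q ∈ points s → q' ∈ points s → q ℚ.< q' →
    rank s q ℕ.< rank s q'
  rank-mono (i ∷ s) (i<s ∷ s↑) {q} {q'} q∈ q'∈ q<q' = from-cases q∈ q'∈ q<q'
    where
    from-cases : q ∈ points (i ∷ s) → q' ∈ points (i ∷ s) → q ℚ.< q' → rank (i ∷ s) q ℕ.< rank (i ∷ s) q'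
    from-cases (here refl) (here refl) q<q' = ⊥-elim (ℚP.<-irrefl refl q<q')
    from-cases (here refl) (there (here refl)) _ rewrite rank-left i s | rank-right i s = ℕP.≤-refl
    from-cases (here refl) (there (there q'∈s)) _
      rewrite rank-left i s | rank-beyond i s (points-above s i<s q'∈s) = ℕ.s≤s ℕ.z≤n
    from-cases (there (here refl)) (here refl) q<q' = ⊥-elim (ℚP.<-asym q<q' (left<right i))
    from-cases (there (here refl)) (there (here refl)) q<q' = ⊥-elim (ℚP.<-irrefl refl q<q')
    from-cases (there (here refl)) (there (there q'∈s)) _
      rewrite rank-right i s | rank-beyond i s (points-above s i<s q'∈s) = ℕ.s≤s (ℕ.s≤s ℕ.z≤n)
    from-cases (there (there q∈s)) (here refl) q<q' =
      ⊥-elim (ℚP.<-asym q<q' (ℚP.<-trans (left<right i) (points-above s i<s q∈s)))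
    from-cases (there (there q∈s)) (there (here refl)) q<q' = ⊥-elim (ℚP.<-asym q<q' (points-above s i<s q∈s))
    from-cases (there (there q∈s)) (there (there q'∈s)) q<q'
      rewrite rank-beyond i s (points-above s i<s q∈s) | rank-beyond i s (points-above s i<s q'∈s) =
      ℕ.s≤s (ℕ.s≤s (rank-mono s s↑ q∈s q'∈s q<q'))

  rank-bound : ∀ s → AllPairs ℤ._<_ s → ∀ {q} → q ∈ points s → rank s q ℕ.< double (length s)
  rank-bound (i ∷ s) _ (here refl) rewrite rank-left i s = ℕ.s≤s ℕ.z≤n
  rank-bound (i ∷ s) _ (there (here refl)) rewrite rank-right i s = ℕ.s≤s (ℕ.s≤s ℕ.z≤n)
  rank-bound (i ∷ s) (i<s ∷ s↑) (there (there q∈s)) rewrite rank-beyond i s (points-above s i<s q∈s) =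
    ℕ.s≤s (ℕ.s≤s (rank-bound s s↑ q∈s))

  rank-pair : ∀ s → AllPairs ℤ._<_ s → ∀ {i} → i ∈ s →
    ∃[ k ] rank s (left i) ≡ double k × rank s (right i) ≡ suc (double k)
  rank-pair (i ∷ s) _ (here refl) = 0 , rank-left i s , rank-right i s
  rank-pair (h ∷ s) (h<s ∷ s↑) {i} (there i∈s) with k , left≡ , right≡ ← rank-pair s s↑ i∈s =
    suc k , trans (rank-beyond h s (right<left h<i)) (cong (suc ∘ suc) left≡)
          , trans (rank-beyond h s (right-mono h<i)) (cong (suc ∘ suc) right≡)
    where h<i = All.lookup h<s i∈s

  colouring : (ℕ → Bool) → List ℤ → ℚ → Bool
  colouring e s = restrict (points s) (alternating e ∘ rank s)

  colouring-splits : ∀ e s → AllPairs ℤ._<_ s → ∀ {i} → i ∈ s →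
    colouring e s (left i) xor colouring e s (right i) ≡ true
  colouring-splits e s s↑ {i} i∈s with k , left≡ , right≡ ← rank-pair s s↑ i∈s
    rewrite restrict-in (points s) (alternating e ∘ rank s) (left∈points i∈s)
          | restrict-in (points s) (alternating e ∘ rank s) (right∈points i∈s)
          | left≡ | right≡ | alternating-even e k | alternating-odd e k with e k
  ... | true = refl
  ... | false = refl

  colouring-avoids : ∀ {d} (η : Fin (suc d) → Bool) s → AllPairs ℤ._<_ s → length s ℕ.≤ d →
    ¬ Induces (colouring (extend η) s) η (points s)
  colouring-avoids {d} η s s↑ s≤d (b , b↑ , b∈ , b-spells) = ℕP.<-irrefl refl (begin-strict
    double d                       ≡⟨ cong double (sym (FinP.toℕ-fromℕ d)) ⟩
    double (toℕ (Fin.fromℕ d))     <⟨ alternating-late (extend η) r r↑ spells (Fin.fromℕ d) ⟩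
    r (Fin.fromℕ d)                <⟨ rank-bound s s↑ (b∈ (Fin.fromℕ d)) ⟩
    double (length s)              ≤⟨ double-mono s≤d ⟩
    double d                       ∎)
    where
    open ℕP.≤-Reasoning
    r : Fin (suc d) → ℕ
    r t = rank s (b t)
    r↑ : ∀ u v → u Fin.< v → r u ℕ.< r v
    r↑ u v u<v = rank-mono s s↑ (b∈ u) (b∈ v) (b↑ u v u<v)
    spells : ∀ t → alternating (extend η) (r t) ≡ extend η (toℕ t)
    spells t = trans (sym (restrict-in (points s) (alternating (extend η) ∘ rank s) (b∈ t)))
                     (trans (b-spells t) (sym (extend-toℕ η t)))

  splits : ∀ {n} → QF (suc n) → (Fin n → ℚ) → ℤ → Bool
  splits φ a i = sat φ (left i) a xor sat φ (right i) a

  -- A split pair contains a parameter: by order invariance, a pair containing none is not split.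
  split-has-parameter : ∀ {n} (φ : QF (suc n)) {a} → Increasing a → ∀ {i} →
    splits φ a i ≡ true → ∃[ j ] InPair i (a j)
  split-has-parameter φ {a} a↑ {i} split = decide (FinP.any? (λ j → inPair? i (a j)))
    where
    unsplit : ¬ (∃[ j ] InPair i (a j)) → splits φ a i ≡ false
    unsplit none = trans (cong (_xor sat φ (right i) a) endpoints-agree) (BoolP.xor-same (sat φ (right i) a))
      where
      endpoints-agree : sat φ (left i) a ≡ sat φ (right i) a
      endpoints-agree = sat-sameOrder φ a↑ a↑ (λ j → outside-pair-sameOrder (λ i∋aj → none (j , i∋aj)))
    decide : Dec (∃[ j ] InPair i (a j)) → ∃[ j ] InPair i (a j)
    decide (yes found) = found
    decide (no none) with () ← trans (sym split) (unsplit none)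

  pick : (ℚ → Bool) → ℤ → Bool → ℚ
  pick f i e = if does (f (left i) BoolP.≟ e) then left i else right i

  pick-value : ∀ (f : ℚ → Bool) i e → f (left i) xor f (right i) ≡ true → f (pick f i e) ≡ e
  pick-value f i e split with f (left i) BoolP.≟ e
  ... | yes fl≡e = fl≡e
  ... | no fl≢e = other-side (f (left i)) (f (right i)) split fl≢e
    where
    other-side : ∀ x y {e} → x xor y ≡ true → x ≢ e → y ≡ e
    other-side true false {false} _ _ = refl
    other-side false true {true} _ _ = refl
    other-side true _ {true} _ x≢e = ⊥-elim (x≢e refl)
    other-side false _ {false} _ x≢e = ⊥-elim (x≢e refl)

  pick-bounds : ∀ (f : ℚ → Bool) i e → InPair i (pick f i e)
  pick-bounds f i e with does (f (left i) BoolP.≟ e)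
  ... | true = ℚP.≤-refl , ℚP.<⇒≤ (left<right i)
  ... | false = ℚP.<⇒≤ (left<right i) , ℚP.≤-refl

  pick∈points : ∀ (f : ℚ → Bool) {s i} e → i ∈ s → pick f i e ∈ points s
  pick∈points f {i = i} e i∈s with does (f (left i) BoolP.≟ e)
  ... | true = left∈points i∈s
  ... | false = right∈points i∈s

  -- Otherwise choosing, in d+1 of these pairs, the endpoint where φ(·; a)
  -- agrees with η shows that the trace of φ(·; a) on the points of s induces η.
  split-pairs-bounded : ∀ {n d} (φ : QF (suc n)) (η : Fin (suc d) → Bool) →
    FinitelyCharacterized φ η → ∀ {a s} → Increasing a → AllPairs ℤ._<_ s →
    (∀ {i} → i ∈ s → splits φ a i ≡ true) → length s ℕ.≤ d
  split-pairs-bounded {d = d} φ η fc {a} {s} a↑ s↑ all-split with length s ℕ.≤? d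
  ... | yes s≤d = s≤d
  ... | no s≰d = ⊥-elim (Equivalence.to (fc (points s) c (restrict-sub (points s) f)) in-trace induces)
    where
    f : ℚ → Bool
    f q = sat φ q a
    c : ℚ → Bool
    c = restrict (points s) f
    in-trace : InTrace φ (points s) c
    in-trace = a , a↑ , λ q q∈ → restrict-in (points s) f q∈
    pair : Fin (suc d) → ℤ
    pair t = List.lookup s (Fin.inject≤ t (ℕP.≰⇒> s≰d))
    pair∈s : ∀ t → pair t ∈ s
    pair∈s t = ∈-lookup _
    pair↑ : ∀ t t' → t Fin.< t' → pair t ℤ.< pair t'
    pair↑ t t' t<t' = lookup-pairwise s↑
      (subst₂ ℕ._<_ (sym (FinP.toℕ-inject≤ t _)) (sym (FinP.toℕ-inject≤ t' _)) t<t')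
    b : Fin (suc d) → ℚ
    b t = pick f (pair t) (η t)
    induces : Induces c η (points s)
    induces = b
            , (λ t t' t<t' → ℚP.≤-<-trans (proj₂ (pick-bounds f (pair t) (η t)))
                (ℚP.<-≤-trans (right<left (pair↑ t t' t<t')) (proj₁ (pick-bounds f (pair t') (η t')))))
            , (λ t → pick∈points f (η t) (pair∈s t))
            , (λ t → trans (restrict-in (points s) f (pick∈points f (η t) (pair∈s t)))
                           (pick-value f (pair t) (η t) (all-split (pair∈s t))))

  SplitsExactly : ∀ {n} → QF (suc n) → List ℤ → Set
  SplitsExactly {n} φ s = Σ (Fin n → ℚ) λ a → Increasing a × (∀ i → (splits φ a i ≡ true) ⇔ (i ∈ s))

  -- Finite characterisation realises the alternating
  -- colouring of the points of s by parameters a; relocating a out of the pairs not in s keeps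
  -- its trace on the points of s and leaves every other pair unsplit.
  realize : ∀ {n d} (φ : QF (suc n)) (η : Fin (suc d) → Bool) →
    FinitelyCharacterized φ η → ∀ {s} → AllPairs ℤ._<_ s → length s ℕ.≤ d → SplitsExactly φ s
  realize {n} φ η fc {s} s↑ s≤d = from-trace
    (Equivalence.from (fc (points s) c (restrict-sub (points s) _)) (colouring-avoids η s s↑ s≤d))
    where
    c : ℚ → Bool
    c = colouring (extend η) s
    from-trace : InTrace φ (points s) c → SplitsExactly φ s
    from-trace (a , a↑ , a-colours) = a' , a'↑ , λ i → mk⇔ only-s split-s
      where
      a' : Fin n → ℚ
      a' j = relocate (+ 0) s (a j) (toℕ j)
      a'↑ : Increasing a'
      a'↑ i j i<j = relocate-mono (+ 0) s s↑ (a↑ i j i<j) i<j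
      keeps-colour : ∀ {q} → q ∈ points s → sat φ q a' ≡ c q
      keeps-colour {q} q∈ =
        trans (sym (sat-sameOrder φ a↑ a'↑ (λ j → relocate-sameOrder (+ 0) s s↑ q∈ (a j) (toℕ j))))
              (sym (a-colours q q∈))
      split-s : ∀ {i} → i ∈ s → splits φ a' i ≡ true
      split-s i∈s = trans (cong₂ _xor_ (keeps-colour (left∈points i∈s)) (keeps-colour (right∈points i∈s)))
                          (colouring-splits (extend η) s s↑ i∈s)
      only-s : ∀ {i} → splits φ a' i ≡ true → i ∈ s
      only-s {i} split with j , i∋a'j ← split-has-parameter φ a'↑ split =
        relocate-avoids (+ 0) s (a j) (toℕ j) i i∋a'j

x<x+1 : ∀ x → x ℤ.< x ℤ.+ + 1
x<x+1 x = subst (x ℤ.<_) (ℤP.+-comm (+ 1) x) (ℤP.suc[i]≤j⇒i<j ℤP.≤-refl)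

odd<even : ∀ {i k} → i ℤ.< k → + 2 ℤ.* i ℤ.+ + 1 ℤ.< + 2 ℤ.* k
odd<even {i} {k} i<k = ℤP.<-≤-trans (subst (+ 2 ℤ.* i ℤ.+ + 1 ℤ.<_) (sym (double-suc i)) (x<x+1 _))
                                    (ℤP.*-monoˡ-≤-nonNeg (+ 2) (ℤP.i<j⇒suc[i]≤j i<k))
  where
  double-suc : ∀ i → + 2 ℤ.* (+ 1 ℤ.+ i) ≡ (+ 2 ℤ.* i ℤ.+ + 1) ℤ.+ + 1
  double-suc = solve-∀

module ℤ* = PairChain (λ i → ι (+ 2 ℤ.* i)) (λ i → ι (+ 2 ℤ.* i ℤ.+ + 1))
                      (λ i → ι-mono-< (x<x+1 (+ 2 ℤ.* i))) (λ i<k → ι-mono-< (odd<even i<k))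

zstar-index-bound : ∀ {i x K} → ℤ*.InPair i x → numBound x ℕ.≤ K → ℤ.- (+ K) ℤ.≤ i × i ℤ.≤ + K
zstar-index-bound {i} {x} {K} (2i≤x , x≤2i+1) x≤K = lower , upper
  where
  2i≤K : + 2 ℤ.* i ℤ.≤ + K
  2i≤K = ι-cancel-≤ (ℚP.≤-trans 2i≤x (ℚP.≤-trans (ι-upper x) (ι-mono-≤ (ℤ.+≤+ x≤K))))
  -K≤2i+1 : ℤ.- (+ K) ℤ.≤ + 2 ℤ.* i ℤ.+ + 1
  -K≤2i+1 = ι-cancel-≤ (ℚP.≤-trans (ι-mono-≤ (ℤP.neg-mono-≤ (ℤ.+≤+ x≤K))) (ℚP.≤-trans (ι-lower x) x≤2i+1))
  upper : i ℤ.≤ + K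
  upper = halve i 2i≤K
    where
    halve : ∀ i → + 2 ℤ.* i ℤ.≤ + K → i ℤ.≤ + K
    halve -[1+ _ ] _ = ℤ.-≤+
    halve (+ m) 2m≤K =
      ℤ.+≤+ (ℕP.≤-trans (ℕP.m≤m+n m (m ℕ.+ 0)) (ℤP.drop‿+≤+ (subst (ℤ._≤ + K) (sym (ℤP.pos-* 2 m)) 2m≤K)))
  lower : ℤ.- (+ K) ℤ.≤ i
  lower = ℤP.≮⇒≥ λ i<-K → ℤP.<-irrefl refl (ℤP.<-≤-trans (ℤP.<-≤-trans (odd<even i<-K) -2K≤-K) -K≤2i+1)
    where
    twice : ∀ w → + 2 ℤ.* w ≡ w ℤ.+ w
    twice = solve-∀
    -2K≤-K : + 2 ℤ.* ℤ.- (+ K) ℤ.≤ ℤ.- (+ K)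
    -2K≤-K = subst₂ ℤ._≤_ (sym (twice _)) (ℤP.+-identityʳ _) (ℤP.+-monoʳ-≤ (ℤ.- (+ K)) ℤP.neg-≤-pos)

parameterBound : ∀ {n} → (Fin n → ℚ) → ℕ
parameterBound {n} a = max 0 (List.map (numBound ∘ a) (List.allFin n))

split-index-bound : ∀ {n} (φ : QF (suc n)) {a} → Increasing a → ∀ {i} → ℤ*.splits φ a i ≡ true →
  ℤ.- (+ parameterBound a) ℤ.≤ i × i ℤ.≤ + parameterBound a
split-index-bound φ {a} a↑ {i} split with j , i∋aj ← ℤ*.split-has-parameter φ a↑ {i} split =
  zstar-index-bound {i} {a j} i∋aj (≤max (∈-map⁺ (numBound ∘ a) (∈-allFin j)))

lemma4p5 : (n d : ℕ) (φ : QF (suc n)) (η : Fin (suc d) → Bool) →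
    FinitelyCharacterized φ η →
    (T : ℤ → Bool) → InPsiFamily φ T ⇔ AtMost d T
lemma4p5 n d φ η fc T = mk⇔ forward backward
  where
  open ℤ*

  forward : InPsiFamily φ T → AtMost d T
  forward (a , a↑ , T≡split) = short (enumerate T (parameterBound a) bounded)
    where
    bounded : ∀ i → T i ≡ true → ℤ.- (+ parameterBound a) ℤ.≤ i × i ℤ.≤ + parameterBound a
    bounded i Ti = split-index-bound φ a↑ {i} (trans (sym (T≡split i)) Ti)
    short : IncreasingListing T → AtMost d T
    short (s , s↑ , T⇔s) =
      s , split-pairs-bounded φ η fc a↑ s↑ (λ {i} i∈s → trans (sym (T≡split i)) (Equivalence.from (T⇔s i) i∈s)) , T⇔s

  backward : AtMost d T → InPsiFamily φ T
  backward (l , l≤d , T⇔l) = realized (enumerate T (listBound l) (λ i → listed-bound ∘ Equivalence.to (T⇔l i)))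
    where
    realized : IncreasingListing T → InPsiFamily φ T
    realized (s , s↑ , T⇔s) = exactly-s (realize φ η fc s↑ (ℕP.≤-trans (increasing-listing-shortest s↑ T⇔s T⇔l) l≤d))
      where
      exactly-s : SplitsExactly φ s → InPsiFamily φ T
      exactly-s (a , a↑ , split⇔s) = a , a↑ , λ i → same-truth (T⇔s i) (split⇔s i)
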